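{- Assume every coalgebra operation in $\mathsf{Op}$ and every test in $\mathsf{Te}$ is reducible. If there exists a quasi-canonical standard model $\zeta$ for $\mathcal L^{\mathsf{Dyn}}_{\mathsf F,\Lambda}$, then for all $\Gamma\subseteq\mathsf{Form}$ and $\varphi\in\mathsf{Form}$: $\Gamma\vdash_{\mathcal L^{\mathsf{Dyn}}_{\mathsf F,\Lambda}}\varphi$ if and only if $\Gamma\models\varphi$.
   Context: $\mathbf{A}=\langle A,\wedge,\vee,\odot,\to,0,1\rangle$ is an $\mathsf{FL}_{ew}$-algebra: $\langle A,\wedge,\vee,0,1\rangle$ a bounded lattice, $\langle A,\odot,1\rangle$ a commutative monoid, and $x\odot y\le z\iff x\le y\to z$; it may carry further operations, $\mathsf{sign}(\mathbf A)$ is its full signature. $A^X$ is the set of maps $X\to A$, $o^{\mathrm{pw}}$ denotes pointwise operations, and $\varphi\leftrightarrow\psi$ abbreviates $(\varphi\to\psi)\wedge(\psi\to\varphi)$. $\mathsf F$ is a $\mathbf{Set}$-endofunctor; an $\mathsf F$-coalgebra is a map $X\to\mathsf FX$. A $k$-ary $A$-predicate lifting for $\mathsf F$ is a family $\lambda_X:(A^X)^k\to A^{\mathsf FX}$ with $\lambda_X(\sigma_1\circ f,\dots,\sigma_k\circ f)=\lambda_Y(\sigma_1,\dots,\sigma_k)\circ\mathsf Ff$ for all $f:X\to Y$. An $n$-ary coalgebra operation $O$ assigns to each $n$-tuple $\vec\gamma$ of $\mathsf F$-coalgebras on a set $X$ an $\mathsf F$-coalgebra $O(\vec\gamma)$ on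 $X$; an $A$-test assigns to each $\sigma\in A^X$ an $\mathsf F$-coalgebra $\mathsf{test}(\sigma)$ on $X$. Fix a countably infinite $\mathsf{Prop}$, countable $\mathsf{At}$, countable collection $\Lambda$ of predicate liftings, finite $\mathsf{Op}$ and finite $\mathsf{Te}$. Formulas: $\varphi::=p\mid o(\varphi_1,\dots)\ (o\in\mathsf{sign}(\mathbf A))\mid\langle a\rangle^\lambda(\varphi_1,\dots,\varphi_{\mathsf{ar}(\lambda)})$; actions: $a::=a_0\in\mathsf{At}\mid O(a_1,\dots,a_{\mathsf{ar}(O)})\mid\mathsf{test}(\varphi)$. A model on $X$: $\gamma:\mathsf{Act}\to(\mathsf FX)^X$ with valuation $[\![\cdot]\!]:\mathsf{Prop}\to A^X$, extended by $[\![o(\vec\varphi)]\!]=o^{\mathrm{pw}}([\![\vec\varphi]\!])$, $[\![\langle a\rangle^\lambda(\vec\varphi)]\!]=\lambda_X([\![\varphi_1]\!],\dots)\circ\gamma_a$; standard if $\gamma_{O(\vec a)}=O(\gamma_{a_1},\dots)$ and $\gamma_{\mathsf{test}(\psi)}=\mathsf{test}([\![\psi]\!])$ always. Local semantic entailment: $\Gamma\models\varphi$ iff for every state $x$ of every standard model, $[\![\psi]\!](x)=1$ for all $\psi\in\Gamma$ implies $[\![\varphi]\!](x)=1$. Reducibility: $(n,k)$-templates $\tau::=\omega_1\mid\dots\mid\omega_k\mid o(\tau_1,\dots)\mid\langle j\rangle^\lambda(\tau_1,\dots)$, $j\le n$; $\tau[\vec a,\vec\varphi]$ substitutes $\varphi_i$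 for $\omega_i$ and $\langle a_j\rangle^\lambda$ for $\langle j\rangle^\lambda$; $\tau[\vec\gamma,\vec\sigma]\in A^X$ is given by $\omega_i\mapsto\sigma_i$, $o$ pointwise, $\langle j\rangle^\lambda(\tau_1,\dots,\tau_m)\mapsto\lambda_X(\tau_1[\vec\gamma,\vec\sigma],\dots,\tau_m[\vec\gamma,\vec\sigma])\circ\gamma_j$. $O$ is reducible w.r.t. $k$-ary $\lambda$ via $\tau$ if $\lambda_X(\vec\sigma)\circ O(\vec\gamma)=\tau[\vec\gamma,\vec\sigma]$ always; a test is reducible w.r.t. $\lambda$ via a $(k+1)$-ary $\mathbf A$-term function $t$ if $\lambda_X(\sigma_1,\dots,\sigma_k)\circ\mathsf{test}(\sigma)=t^{\mathrm{pw}}(\sigma,\sigma_1,\dots,\sigma_k)$ always; reducible means w.r.t. every $\lambda\in\Lambda$. $\mathcal L_{\mathsf F,\Lambda}$ is a set of axioms and rules with modalities $\heartsuit^\lambda$, assumed a sound and strongly complete axiomatization of the $\mathbf A$-valued coalgebraic modal logic of $\mathsf F$ and $\Lambda$. With fixed witnesses $\tau_{O,\lambda}$, $t_{\mathsf{test},\lambda}$, $\mathcal L^{\mathsf{Dyn}}_{\mathsf F,\Lambda}$ is the smallest set of formulas that for every action $a$ contains all instances of axioms of $\mathcal L_{\mathsf F,\Lambda}$ with $\heartsuit^\lambda$ read as $\langle a\rangle^\lambda$ and is closed under the corresponding rules, and contains all $\langle O(\vec a)\rangle^\lambda(\vec\varphi)\leftrightarrow\tau_{O,\lambda}[\vec a,\vec\varphi]$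 and $\langle\mathsf{test}(\psi)\rangle^\lambda(\vec\varphi)\leftrightarrow t_{\mathsf{test},\lambda}(\psi,\vec\varphi)$. $\mathsf{NMH}$ is the set of maps $h:\mathsf{Form}\to A$ commuting with all operations of $\mathsf{sign}(\mathbf A)$ and with $h(\mathcal L^{\mathsf{Dyn}}_{\mathsf F,\Lambda})=\{1\}$; $\mathsf{ev}_\varphi(h)=h(\varphi)$. Syntactic entailment: $\Gamma\vdash_{\mathcal L^{\mathsf{Dyn}}_{\mathsf F,\Lambda}}\varphi$ iff every $h\in\mathsf{NMH}$ with $h(\Gamma)=\{1\}$ has $h(\varphi)=1$. A quasi-canonical model is a model $\zeta$ on $\mathsf{NMH}$ with valuation $[\![p]\!]^c=\mathsf{ev}_p$ such that $[\![\varphi]\!]^c=\mathsf{ev}_\varphi$ for all formulas. -}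

module Defs where

open import Data.Nat using (ℕ; suc)
open import Data.Fin using (Fin)
open import Data.Vec using (Vec; []; _∷_; map; lookup)
open import Data.Product using (Σ; ∃; _×_; _,_; proj₁)
open import Data.Sum using (_⊎_; inj₁; inj₂)
open import Function using (id; _∘_)
open import Relation.Binary.PropositionalEquality using (_≡_)

record FLew : Set₁ where
  field
    Carrier : Set
    _⊓_ _⊔_ _⊙_ _⇒_ : Carrier → Carrier → Carrier
    𝟘 𝟙 : Carrier
    Extra : Set
    arE : Extra → ℕ
    ⟦_⟧E : (e : Extra) → Vec Carrier (arE e) → Carrier
    -- bounded lattice (order: x ≤ y iff x ⊓ y ≡ x), bottom 𝟘, top 𝟙
    ⊓-assoc : ∀ x y z → (x ⊓ y) ⊓ z ≡ x ⊓ (y ⊓ z)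
    ⊓-comm : ∀ x y → x ⊓ y ≡ y ⊓ x
    ⊔-assoc : ∀ x y z → (x ⊔ y) ⊔ z ≡ x ⊔ (y ⊔ z)
    ⊔-comm : ∀ x y → x ⊔ y ≡ y ⊔ x
    ⊓-absorbs-⊔ : ∀ x y → x ⊓ (x ⊔ y) ≡ x
    ⊔-absorbs-⊓ : ∀ x y → x ⊔ (x ⊓ y) ≡ x
    𝟘-least : ∀ x → 𝟘 ⊓ x ≡ 𝟘
    𝟙-greatest : ∀ x → x ⊓ 𝟙 ≡ x
    ⊙-assoc : ∀ x y z → (x ⊙ y) ⊙ z ≡ x ⊙ (y ⊙ z)
    ⊙-comm : ∀ x y → x ⊙ y ≡ y ⊙ x
    ⊙-identity : ∀ x → x ⊙ 𝟙 ≡ x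
    residuation₁ : ∀ x y z → (x ⊙ y) ⊓ z ≡ x ⊙ y → x ⊓ (y ⇒ z) ≡ x
    residuation₂ : ∀ x y z → x ⊓ (y ⇒ z) ≡ x → (x ⊙ y) ⊓ z ≡ x ⊙ y

data BasicOp : Set where
  meet join fusion impl bot top : BasicOp

arB : BasicOp → ℕ
arB meet = 2
arB join = 2
arB fusion = 2
arB impl = 2
arB bot = 0
arB top = 0

Sig : FLew → Set
Sig 𝔸 = BasicOp ⊎ FLew.Extra 𝔸

ar : (𝔸 : FLew) → Sig 𝔸 → ℕ
ar 𝔸 (inj₁ b) = arB b
ar 𝔸 (inj₂ e) = FLew.arE 𝔸 e

interp : (𝔸 : FLew) (o : Sig 𝔸) → Vec (FLew.Carrier 𝔸) (ar 𝔸 o) → FLew.Carrier 𝔸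
interp 𝔸 (inj₁ meet) (x ∷ y ∷ []) = FLew._⊓_ 𝔸 x y
interp 𝔸 (inj₁ join) (x ∷ y ∷ []) = FLew._⊔_ 𝔸 x y
interp 𝔸 (inj₁ fusion) (x ∷ y ∷ []) = FLew._⊙_ 𝔸 x y
interp 𝔸 (inj₁ impl) (x ∷ y ∷ []) = FLew._⇒_ 𝔸 x y
interp 𝔸 (inj₁ bot) [] = FLew.𝟘 𝔸
interp 𝔸 (inj₁ top) [] = FLew.𝟙 𝔸
interp 𝔸 (inj₂ e) xs = FLew.⟦_⟧E 𝔸 e xs

record SetFunctor : Set₁ where
  field
    F₀ : Set → Set
    fmap : {X Y : Set} → (X → Y) → F₀ X → F₀ Y
    fmap-id : ∀ {X} (t : F₀ X) → fmap id t ≡ t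
    fmap-∘ : ∀ {X Y Z} (f : X → Y) (g : Y → Z) (t : F₀ X) →
             fmap (g ∘ f) t ≡ fmap g (fmap f t)
    fmap-cong : ∀ {X Y} {f g : X → Y} → (∀ x → f x ≡ g x) →
                ∀ t → fmap f t ≡ fmap g t

record PredLifting (𝔸 : FLew) (F : SetFunctor) (k : ℕ) : Set₁ where
  open FLew 𝔸 using (Carrier)
  open SetFunctor F
  field
    apply : {X : Set} → Vec (X → Carrier) k → F₀ X → Carrier
    natural : ∀ {X Y} (f : X → Y) (σs : Vec (Y → Carrier) k) (t : F₀ X) →
              apply (map (_∘ f) σs) t ≡ apply σs (fmap f t)
    apply-cong : ∀ {X} (σs τs : Vec (X → Carrier) k) →
                 (∀ i x → lookup σs i x ≡ lookup τs i x) →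
                 ∀ t → apply σs t ≡ apply τs t

Countable : Set → Set
Countable S = Σ (S → ℕ) λ c → ∀ a b → c a ≡ c b → a ≡ b

Finite : Set → Set
Finite S = Σ ℕ λ n → Σ (Fin n → S) λ e → ∀ s → ∃ λ i → e i ≡ s

record Language : Set₁ where
  field
    alg : FLew
    fun : SetFunctor
  open FLew alg using (Carrier)
  open SetFunctor fun using (F₀)
  field
    At : Set
    At-countable : Countable At
    Λ : Set
    Λ-countable : Countable Λ
    arΛ : Λ → ℕ
    lift : (l : Λ) → PredLifting alg fun (arΛ l)
    Op : Set
    Op-finite : Finite Op
    arO : Op → ℕ
    coop : (o : Op) {X : Set} → Vec (X → F₀ X) (arO o) → X → F₀ X
    Te : Set
    Te-finite : Finite Te
    test : Te → {X : Set} → (X → Carrier) → X → F₀ X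

module _ (L : Language) where
  open Language L
  open FLew alg
  open SetFunctor fun

  mutual
    data Form : Set where
      fvar : ℕ → Form
      fop : (o : Sig alg) → Vec Form (ar alg o) → Form
      fdia : Act → (l : Λ) → Vec Form (arΛ l) → Form

    data Act : Set where
      atom : At → Act
      cop : (o : Op) → Vec Act (arO o) → Act
      tst : Te → Form → Act

  _↔f_ : Form → Form → Form
  φ ↔f ψ = fop (inj₁ meet) (fop (inj₁ impl) (φ ∷ ψ ∷ []) ∷ fop (inj₁ impl) (ψ ∷ φ ∷ []) ∷ [])

  record Model (X : Set) : Set where
    field
      act : Act → X → F₀ X
      val : ℕ → X → Carrier
  open Model

  mutual
    eval : {X : Set} → Model X → Form → X → Carrier
    eval M (fvar p) = val M p
    eval M (fop o φs) x = interp alg o (map (λ f → f x) (evalV M φs))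
    eval M (fdia a l φs) x = PredLifting.apply (lift l) (evalV M φs) (act M a x)

    evalV : {X : Set} {n : ℕ} → Model X → Vec Form n → Vec (X → Carrier) n
    evalV M [] = []
    evalV M (φ ∷ φs) = eval M φ ∷ evalV M φs

  Standard : {X : Set} → Model X → Set
  Standard M =
    (∀ o as x → act M (cop o as) x ≡ coop o (map (act M) as) x) ×
    (∀ te ψ x → act M (tst te ψ) x ≡ test te (eval M ψ) x)

  Entails : (Form → Set) → Form → Set₁
  Entails Γ φ = ∀ (X : Set) (M : Model X) → Standard M → ∀ x →
                (∀ ψ → Γ ψ → eval M ψ x ≡ 𝟙) → eval M φ x ≡ 𝟙

  data Template (n k : ℕ) : Set where
    tω : Fin k → Template n k
    top : (o : Sig alg) → Vec (Template n k) (ar alg o) → Template n k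
    tdia : Fin n → (l : Λ) → Vec (Template n k) (arΛ l) → Template n k

  mutual
    tsubst : {n k : ℕ} → Template n k → Vec Act n → Vec Form k → Form
    tsubst (tω i) as φs = lookup φs i
    tsubst (top o τs) as φs = fop o (tsubstV τs as φs)
    tsubst (tdia j l τs) as φs = fdia (lookup as j) l (tsubstV τs as φs)

    tsubstV : {n k m : ℕ} → Vec (Template n k) m → Vec Act n → Vec Form k → Vec Form m
    tsubstV [] as φs = []
    tsubstV (τ ∷ τs) as φs = tsubst τ as φs ∷ tsubstV τs as φs

  mutual
    tsem : {X : Set} {n k : ℕ} → Template n k → Vec (X → F₀ X) n →
           Vec (X → Carrier) k → X → Carrier
    tsem (tω i) γs σs = lookup σs i
    tsem (top o τs) γs σs x = interp alg o (map (λ f → f x) (tsemV τs γs σs))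
    tsem (tdia j l τs) γs σs x =
      PredLifting.apply (lift l) (tsemV τs γs σs) (lookup γs j x)

    tsemV : {X : Set} {n k m : ℕ} → Vec (Template n k) m → Vec (X → F₀ X) n →
            Vec (X → Carrier) k → Vec (X → Carrier) m
    tsemV [] γs σs = []
    tsemV (τ ∷ τs) γs σs = tsem τ γs σs ∷ tsemV τs γs σs

  data Term (m : ℕ) : Set where
    tvar : Fin m → Term m
    tapp : (o : Sig alg) → Vec (Term m) (ar alg o) → Term m

  mutual
    termEval : {m : ℕ} → Term m → Vec Carrier m → Carrier
    termEval (tvar i) xs = lookup xs i
    termEval (tapp o ts) xs = interp alg o (termEvalV ts xs)

    termEvalV : {m j : ℕ} → Vec (Term m) j → Vec Carrier m → Vec Carrier j
    termEvalV [] xs = []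
    termEvalV (t ∷ ts) xs = termEval t xs ∷ termEvalV ts xs

  mutual
    termForm : {m : ℕ} → Term m → Vec Form m → Form
    termForm (tvar i) φs = lookup φs i
    termForm (tapp o ts) φs = fop o (termFormV ts φs)

    termFormV : {m j : ℕ} → Vec (Term m) j → Vec Form m → Vec Form j
    termFormV [] φs = []
    termFormV (t ∷ ts) φs = termForm t φs ∷ termFormV ts φs

  OpReducibleVia : (o : Op) (l : Λ) → Template (arO o) (arΛ l) → Set₁
  OpReducibleVia o l τ =
    ∀ {X : Set} (γs : Vec (X → F₀ X) (arO o)) (σs : Vec (X → Carrier) (arΛ l)) x →
    PredLifting.apply (lift l) σs (coop o γs x) ≡ tsem τ γs σs x

  TestReducibleVia : (te : Te) (l : Λ) → Term (suc (arΛ l)) → Set₁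
  TestReducibleVia te l t =
    ∀ {X : Set} (σ : X → Carrier) (σs : Vec (X → Carrier) (arΛ l)) x →
    PredLifting.apply (lift l) σs (test te σ x) ≡
      termEval t (σ x ∷ map (λ f → f x) σs)

  data SForm : Set where
    svar : ℕ → SForm
    sop : (o : Sig alg) → Vec SForm (ar alg o) → SForm
    sbox : (l : Λ) → Vec SForm (arΛ l) → SForm

  record SModel (X : Set) : Set where
    field
      coalg : X → F₀ X
      sval : ℕ → X → Carrier
  open SModel

  mutual
    seval : {X : Set} → SModel X → SForm → X → Carrier
    seval M (svar p) = sval M p
    seval M (sop o χs) x = interp alg o (map (λ f → f x) (sevalV M χs))
    seval M (sbox l χs) x = PredLifting.apply (lift l) (sevalV M χs) (coalg M x)

    sevalV : {X : Set} {n : ℕ} → SModel X → Vec SForm n → Vec (X → Carrier) n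
    sevalV M [] = []
    sevalV M (χ ∷ χs) = seval M χ ∷ sevalV M χs

  record AxiomSystem : Set₁ where
    field
      Ax : Set
      axiom : Ax → SForm
      Rule : Set
      Prem : Rule → Set
      premise : (r : Rule) → Prem r → SForm
      concl : Rule → SForm

  SValid : {X : Set} → SModel X → SForm → Set
  SValid M χ = ∀ x → seval M χ x ≡ 𝟙

  Sound : AxiomSystem → Set₁
  Sound AS =
    (∀ a (X : Set) (M : SModel X) → SValid M (axiom a)) ×
    (∀ r (X : Set) (M : SModel X) → (∀ p → SValid M (premise r p)) → SValid M (concl r))
    where open AxiomSystem AS

  mutual
    ssubst : (ℕ → SForm) → SForm → SForm
    ssubst s (svar p) = s p
    ssubst s (sop o χs) = sop o (ssubstV s χs)
    ssubst s (sbox l χs) = sbox l (ssubstV s χs)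

    ssubstV : {n : ℕ} → (ℕ → SForm) → Vec SForm n → Vec SForm n
    ssubstV s [] = []
    ssubstV s (χ ∷ χs) = ssubst s χ ∷ ssubstV s χs

  data InLS (AS : AxiomSystem) : SForm → Set where
    sax : ∀ a (s : ℕ → SForm) → InLS AS (ssubst s (AxiomSystem.axiom AS a))
    srule : ∀ r (s : ℕ → SForm) →
            (∀ p → InLS AS (ssubst s (AxiomSystem.premise AS r p))) →
            InLS AS (ssubst s (AxiomSystem.concl AS r))

  SDerives : AxiomSystem → (SForm → Set) → SForm → Set
  SDerives AS Γ φ =
    ∀ (h : SForm → Carrier) →
    (∀ o χs → h (sop o χs) ≡ interp alg o (map h χs)) →
    (∀ χ → InLS AS χ → h χ ≡ 𝟙) →
    (∀ ψ → Γ ψ → h ψ ≡ 𝟙) → h φ ≡ 𝟙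

  SEntails : (SForm → Set) → SForm → Set₁
  SEntails Γ φ = ∀ (X : Set) (M : SModel X) x →
                 (∀ ψ → Γ ψ → seval M ψ x ≡ 𝟙) → seval M φ x ≡ 𝟙

  StronglyComplete : AxiomSystem → Set₁
  StronglyComplete AS = ∀ Γ φ → SEntails Γ φ → SDerives AS Γ φ

  mutual
    inst : (ℕ → Form) → Act → SForm → Form
    inst s a (svar p) = s p
    inst s a (sop o χs) = fop o (instV s a χs)
    inst s a (sbox l χs) = fdia a l (instV s a χs)

    instV : {n : ℕ} → (ℕ → Form) → Act → Vec SForm n → Vec Form n
    instV s a [] = []
    instV s a (χ ∷ χs) = inst s a χ ∷ instV s a χs

  -- data fixing L^Dyn: the axiom system and the reduction witnesses
  record DynData : Set₁ where
    field
      AS : AxiomSystem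
      τW : (o : Op) (l : Λ) → Template (arO o) (arΛ l)
      tW : (te : Te) (l : Λ) → Term (suc (arΛ l))

module _ (L : Language) (D : DynData L) where
  open Language L
  open FLew alg
  open DynData D
  open AxiomSystem AS

  data InL : Form L → Set where
    ax : ∀ a (s : ℕ → Form L) (b : Act L) → InL (inst L s b (axiom a))
    rule : ∀ r (s : ℕ → Form L) (b : Act L) →
           (∀ p → InL (inst L s b (premise r p))) →
           InL (inst L s b (concl r))
    red-op : ∀ (o : Op) (as : Vec (Act L) (arO o)) (l : Λ) (φs : Vec (Form L) (arΛ l)) →
             InL (_↔f_ L (fdia (cop o as) l φs) (tsubst L (τW o l) as φs))
    red-test : ∀ (te : Te) (ψ : Form L) (l : Λ) (φs : Vec (Form L) (arΛ l)) →
               InL (_↔f_ L (fdia (tst te ψ) l φs) (termForm L (tW te l) (ψ ∷ φs)))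

  IsNMH : (Form L → Carrier) → Set
  IsNMH h = (∀ o φs → h (fop o φs) ≡ interp alg o (map h φs)) ×
            (∀ φ → InL φ → h φ ≡ 𝟙)

  NMH : Set
  NMH = Σ (Form L → Carrier) IsNMH

  Derives : (Form L → Set) → Form L → Set
  Derives Γ φ = ∀ (h : NMH) → (∀ ψ → Γ ψ → proj₁ h ψ ≡ 𝟙) → proj₁ h φ ≡ 𝟙

  QuasiCanonical : Model L NMH → Set
  QuasiCanonical M =
    (∀ p h → Model.val M p h ≡ proj₁ h (fvar p)) ×
    (∀ φ h → eval L M φ h ≡ proj₁ h φ)

-- Soundness: an instance of a static axiom or rule at an action b, evaluated in a
-- standard model, is the static formula evaluated in the coalgebra γ_b, so soundness
-- of the static logic transfers; a reduction axiom φ ↔ ψ holds because reducibility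
-- makes φ and ψ evaluate to the same value, and a ↔ a = 1 in every FL_ew-algebra.
-- Hence evaluation at any state of a standard model is a homomorphism in NMH, and
-- syntactic entailment implies semantic entailment.
-- Completeness: the states of a quasi-canonical model are the homomorphisms h with
-- ⟦φ⟧(h) = h(φ), so semantic entailment at the state h gives h(φ) = 1 directly.
module Submission where

open import Defs
open import Data.Nat using (ℕ)
open import Data.Fin using (zero; suc)
open import Data.Product using (Σ; _×_; _,_; proj₁; proj₂)
open import Data.Vec using (Vec; []; _∷_; map; lookup)
open import Data.Vec.Properties using (lookup-map)
open import Relation.Binary.PropositionalEquality
open ≡-Reasoning

module FLewProperties (𝔸 : FLew) where
  open FLew 𝔸

  ⊓-idem : ∀ a → a ⊓ a ≡ a
  ⊓-idem a = begin
    a ⊓ a              ≡⟨ cong (a ⊓_) (sym (⊔-absorbs-⊓ a a)) ⟩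
    a ⊓ (a ⊔ (a ⊓ a))  ≡⟨ ⊓-absorbs-⊔ a (a ⊓ a) ⟩
    a                  ∎

  ⇒-refl : ∀ a → a ⇒ a ≡ 𝟙
  ⇒-refl a = begin
    a ⇒ a        ≡⟨ sym (𝟙-greatest (a ⇒ a)) ⟩
    (a ⇒ a) ⊓ 𝟙  ≡⟨ ⊓-comm (a ⇒ a) 𝟙 ⟩
    𝟙 ⊓ (a ⇒ a)  ≡⟨ residuation₁ 𝟙 a a 𝟙⊙a≤a ⟩
    𝟙            ∎
    where
    𝟙⊙a≡a : 𝟙 ⊙ a ≡ a
    𝟙⊙a≡a = trans (⊙-comm 𝟙 a) (⊙-identity a)

    𝟙⊙a≤a : (𝟙 ⊙ a) ⊓ a ≡ 𝟙 ⊙ a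
    𝟙⊙a≤a = trans (cong (_⊓ a) 𝟙⊙a≡a) (trans (⊓-idem a) (sym 𝟙⊙a≡a))

  ⇔-refl : ∀ a → (a ⇒ a) ⊓ (a ⇒ a) ≡ 𝟙
  ⇔-refl a = trans (cong₂ _⊓_ (⇒-refl a) (⇒-refl a)) (𝟙-greatest 𝟙)

lookup-pointwise : {X A : Set} {n : ℕ} (v w : Vec (X → A) n) →
                   (∀ x → map (λ f → f x) v ≡ map (λ f → f x) w) →
                   ∀ i x → lookup v i x ≡ lookup w i x
lookup-pointwise v w v≗w i x = begin
  lookup v i x                  ≡⟨ sym (lookup-map i (λ f → f x) v) ⟩
  lookup (map (λ f → f x) v) i  ≡⟨ cong (λ u → lookup u i) (v≗w x) ⟩
  lookup (map (λ f → f x) w) i  ≡⟨ lookup-map i (λ f → f x) w ⟩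
  lookup w i x                  ∎

module Evaluation (L : Language) {X : Set} (M : Model L X) where
  open Language L
  open FLew alg
  open Model M

  evalV-at : ∀ {n} (φs : Vec (Form L) n) x →
             map (λ f → f x) (evalV L M φs) ≡ map (λ φ → eval L M φ x) φs
  evalV-at []       x = refl
  evalV-at (φ ∷ φs) x = cong (eval L M φ x ∷_) (evalV-at φs x)

  lookup-evalV : ∀ {n} (φs : Vec (Form L) n) i →
                 lookup (evalV L M φs) i ≡ eval L M (lookup φs i)
  lookup-evalV (φ ∷ φs) zero    = refl
  lookup-evalV (φ ∷ φs) (suc i) = lookup-evalV φs i

  eval-↔f : ∀ φ ψ x → eval L M φ x ≡ eval L M ψ x → eval L M (_↔f_ L φ ψ) x ≡ 𝟙
  eval-↔f φ ψ x φ≡ψ =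
    trans (cong (λ c → (c ⇒ eval L M ψ x) ⊓ (eval L M ψ x ⇒ c)) φ≡ψ)
          (FLewProperties.⇔-refl alg (eval L M ψ x))

  instanceModel : (ℕ → Form L) → Act L → SModel L X
  instanceModel s b = record { coalg = act b ; sval = λ p → eval L M (s p) }

  mutual
    eval-inst : ∀ s b χ x → eval L M (inst L s b χ) x ≡ seval L (instanceModel s b) χ x
    eval-inst s b (svar p)    x = refl
    eval-inst s b (sop o χs)  x = cong (interp alg o) (eval-instV s b χs x)
    eval-inst s b (sbox l χs) x =
      PredLifting.apply-cong (lift l) _ _ (lookup-pointwise _ _ (eval-instV s b χs)) (act b x)

    eval-instV : ∀ {n} s b (χs : Vec (SForm L) n) x →
                 map (λ f → f x) (evalV L M (instV L s b χs)) ≡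
                 map (λ f → f x) (sevalV L (instanceModel s b) χs)
    eval-instV s b []       x = refl
    eval-instV s b (χ ∷ χs) x = cong₂ _∷_ (eval-inst s b χ x) (eval-instV s b χs x)

  mutual
    eval-tsubst : ∀ {n k} (τ : Template L n k) as φs x →
                  eval L M (tsubst L τ as φs) x ≡ tsem L τ (map act as) (evalV L M φs) x
    eval-tsubst (tω i)        as φs x = sym (cong (λ f → f x) (lookup-evalV φs i))
    eval-tsubst (top o τs)    as φs x = cong (interp alg o) (eval-tsubstV τs as φs x)
    eval-tsubst (tdia j l τs) as φs x = trans
      (PredLifting.apply-cong (lift l) _ _ (lookup-pointwise _ _ (eval-tsubstV τs as φs)) _)
      (cong (PredLifting.apply (lift l) (tsemV L τs (map act as) (evalV L M φs)))
            (sym (cong (λ f → f x) (lookup-map j act as))))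

    eval-tsubstV : ∀ {n k m} (τs : Vec (Template L n k) m) as φs x →
                   map (λ f → f x) (evalV L M (tsubstV L τs as φs)) ≡
                   map (λ f → f x) (tsemV L τs (map act as) (evalV L M φs))
    eval-tsubstV []       as φs x = refl
    eval-tsubstV (τ ∷ τs) as φs x = cong₂ _∷_ (eval-tsubst τ as φs x) (eval-tsubstV τs as φs x)

  mutual
    eval-termForm : ∀ {m} (t : Term L m) ψs x →
                    eval L M (termForm L t ψs) x ≡ termEval L t (map (λ f → f x) (evalV L M ψs))
    eval-termForm (tvar i) ψs x = begin
      eval L M (lookup ψs i) x                   ≡⟨ cong (λ f → f x) (sym (lookup-evalV ψs i)) ⟩
      lookup (evalV L M ψs) i x                  ≡⟨ sym (lookup-map i (λ f → f x) (evalV L M ψs)) ⟩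
      lookup (map (λ f → f x) (evalV L M ψs)) i  ∎
    eval-termForm (tapp o ts) ψs x = cong (interp alg o) (eval-termFormV ts ψs x)

    eval-termFormV : ∀ {m j} (ts : Vec (Term L m) j) ψs x →
                     map (λ f → f x) (evalV L M (termFormV L ts ψs)) ≡
                     termEvalV L ts (map (λ f → f x) (evalV L M ψs))
    eval-termFormV []       ψs x = refl
    eval-termFormV (t ∷ ts) ψs x = cong₂ _∷_ (eval-termForm t ψs x) (eval-termFormV ts ψs x)

module Soundness (L : Language) (D : DynData L)
                 (static-sound : Sound L (DynData.AS D))
                 (op-reducible : ∀ o l → OpReducibleVia L o l (DynData.τW D o l))
                 (test-reducible : ∀ te l → TestReducibleVia L te l (DynData.tW D te l)) where
  open Language L
  open FLew alg
  open DynData D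
  open AxiomSystem AS

  InL-valid : ∀ {X} (M : Model L X) → Standard L M → ∀ {ψ} → InL L D ψ → ∀ x → eval L M ψ x ≡ 𝟙
  InL-valid M std (ax a s b) x =
    trans (eval-inst s b (axiom a) x) (proj₁ static-sound a _ (instanceModel s b) x)
    where open Evaluation L M
  InL-valid M std (rule r s b prems) x =
    trans (eval-inst s b (concl r) x) (proj₂ static-sound r _ (instanceModel s b) premises-valid x)
    where
    open Evaluation L M
    premises-valid : ∀ p → SValid L (instanceModel s b) (premise r p)
    premises-valid p y = trans (sym (eval-inst s b (premise r p) y)) (InL-valid M std (prems p) y)
  InL-valid M std (red-op o as l φs) x =
    eval-↔f (fdia (cop o as) l φs) (tsubst L (τW o l) as φs) x (begin
    PredLifting.apply (lift l) (evalV L M φs) (Model.act M (cop o as) x)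
      ≡⟨ cong (PredLifting.apply (lift l) (evalV L M φs)) (proj₁ std o as x) ⟩
    PredLifting.apply (lift l) (evalV L M φs) (coop o (map (Model.act M) as) x)
      ≡⟨ op-reducible o l (map (Model.act M) as) (evalV L M φs) x ⟩
    tsem L (τW o l) (map (Model.act M) as) (evalV L M φs) x
      ≡⟨ sym (eval-tsubst (τW o l) as φs x) ⟩
    eval L M (tsubst L (τW o l) as φs) x ∎)
    where open Evaluation L M
  InL-valid M std (red-test te ψ l φs) x =
    eval-↔f (fdia (tst te ψ) l φs) (termForm L (tW te l) (ψ ∷ φs)) x (begin
    PredLifting.apply (lift l) (evalV L M φs) (Model.act M (tst te ψ) x)
      ≡⟨ cong (PredLifting.apply (lift l) (evalV L M φs)) (proj₂ std te ψ x) ⟩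
    PredLifting.apply (lift l) (evalV L M φs) (test te (eval L M ψ) x)
      ≡⟨ test-reducible te l (eval L M ψ) (evalV L M φs) x ⟩
    termEval L (tW te l) (map (λ f → f x) (evalV L M (ψ ∷ φs)))
      ≡⟨ sym (eval-termForm (tW te l) (ψ ∷ φs) x) ⟩
    eval L M (termForm L (tW te l) (ψ ∷ φs)) x ∎)
    where open Evaluation L M

  evalAt-isNMH : ∀ {X} (M : Model L X) → Standard L M → ∀ x → IsNMH L D (λ ψ → eval L M ψ x)
  evalAt-isNMH M std x =
    (λ o φs → cong (interp alg o) (Evaluation.evalV-at L M φs x)) ,
    (λ ψ ψ∈L → InL-valid M std ψ∈L x)

  derives⇒entails : ∀ Γ φ → Derives L D Γ φ → Entails L Γ φ
  derives⇒entails Γ φ Γ⊢φ X M std x = Γ⊢φ ((λ ψ → eval L M ψ x) , evalAt-isNMH M std x)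

entails⇒derives : (L : Language) (D : DynData L) (ζ : Model L (NMH L D)) →
                  Standard L ζ → QuasiCanonical L D ζ →
                  ∀ Γ φ → Entails L Γ φ → Derives L D Γ φ
entails⇒derives L D ζ std (_ , truth-is-ev) Γ φ Γ⊨φ h h⊨Γ =
  trans (sym (truth-is-ev φ h)) (Γ⊨φ _ ζ std h (λ ψ ψ∈Γ → trans (truth-is-ev ψ h) (h⊨Γ ψ ψ∈Γ)))

proposition5p4 : (L : Language) (D : DynData L) →
    Sound L (DynData.AS D) →
    StronglyComplete L (DynData.AS D) →
    (∀ o l → OpReducibleVia L o l (DynData.τW D o l)) →
    (∀ te l → TestReducibleVia L te l (DynData.tW D te l)) →
    Σ (Model L (NMH L D)) (λ ζ → Standard L ζ × QuasiCanonical L D ζ) →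
    ∀ (Γ : Form L → Set) (φ : Form L) →
    (Derives L D Γ φ → Entails L Γ φ) × (Entails L Γ φ → Derives L D Γ φ)
proposition5p4 L D static-sound _ op-reducible test-reducible (ζ , std , quasi-canonical) Γ φ =
  Soundness.derives⇒entails L D static-sound op-reducible test-reducible Γ φ ,
  entails⇒derives L D ζ std quasi-canonical Γ φ
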